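{- Let $v\in\mathcal V$ and let $R,S_1,S_2$ be predicate-free schemas such that at least one of $S_1,S_2$ contains an assignment to $v$, each of $RS_1$ and $RS_2$ is liberal, and for every function symbol $f$, if $S_1$ and $S_2$ both contain assignments with function symbol $f$, then every such assignment in $S_1$ assigns to a different variable than every such assignment in $S_2$. Then $M[RS_1]_e(v)\ne M[RS_2]_e(v)$.
   Context: Terms over function symbols (with arities) and variables $\mathcal V$: variables and $f(t_1,\dots,t_n)$. A predicate-free schema is a finite sequence of $\mathtt{skip}$s and assignments $y:=f(\mathbf x);$ ($\mathbf x$ a vector of $\mathrm{arity}(f)$ variables); juxtaposition is concatenation. $e$ is the natural state $e(v)=v$, and $M[S]_e$ is the state (map from variables to terms) obtained from $e$ by executing the assignments of $S$ in order, $y:=f(x_1,\dots,x_n)$ setting $y$ to $f(d(x_1),\dots,d(x_n))$ where $d$ is the current state. A predicate-free schema is liberal if no two of its assignments, executed in order from $e$, assign the same term to their respective variables. -}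

module Defs where

open import Data.Nat using (ℕ)
open import Data.Vec using (Vec; map)
open import Data.List using (List; []; _∷_)
open import Data.Product using (_×_; _,_)
open import Relation.Binary.PropositionalEquality using (_≡_)
open import Relation.Binary.Definitions using (DecidableEquality)
open import Relation.Nullary using (yes; no)

module Schemas (F : Set) (arity : F → ℕ) (V : Set) (_≟V_ : DecidableEquality V) where

  data Term : Set where
    var : V → Term
    app : (f : F) → Vec Term (arity f) → Term

  data Instr : Set where
    skip   : Instr
    assign : (y : V) (f : F) → Vec V (arity f) → Instr

  -- A predicate-free schema: finite sequence of instructions; juxtaposition = _++_.
  Schema : Set
  Schema = List Instr

  State : Set
  State = V → Term

  e : State
  e v = var v

  update : State → V → Term → State
  update d y t v with v ≟V y
  ... | yes _ = t
  ... | no  _ = d v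

  step : State → Instr → State
  step d skip = d
  step d (assign y f xs) = update d y (app f (map d xs))

  run : State → Schema → State
  run d [] = d
  run d (i ∷ S) = run (step d i) S

  M[_]_ : Schema → State → State
  M[ S ] d = run d S

  assignments : State → Schema → List (V × Term)
  assignments d [] = []
  assignments d (skip ∷ S) = assignments d S
  assignments d (assign y f xs ∷ S) =
    (y , app f (map d xs)) ∷ assignments (step d (assign y f xs)) S

  assignedTerms : State → Schema → List Term
  assignedTerms d S = Data.List.map (λ p → Data.Product.proj₂ p) (assignments d S)

  data AssignsTo (v : V) : Instr → Set where
    assigns : ∀ f xs → AssignsTo v (assign v f xs)

  data AssignsWith (f : F) (y : V) : Instr → Set where
    assignsWith : ∀ xs → AssignsWith f y (assign y f xs)

module Submission where

-- Run R first and let d = M[R]_e; then M[R Sᵢ]_e = M[Sᵢ]_d.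
-- For any schema S and state d, the final value of v after running S from d
-- is either untouched (S has no assignment to v and the value is still d v),
-- or it is the term recorded by the last assignment to v in S; in the latter
-- case it has the form f(…) and appears in the list of assigned terms.
-- Suppose M[S₁]_d(v) = M[S₂]_d(v) and compare the two cases:
--   * both untouched: impossible, since S₁ or S₂ assigns to v;
--   * both assigned: the two last assignments to v share their function
--     symbol and their target v, contradicting the disjointness hypothesis;
--   * one assigned, say in S₁: the value d v is either the variable v
--     (no term f(…)) or a term assigned in R, so the term f(…) would be
--     assigned twice in R S₁, contradicting liberality.

open import Defs
open import Data.Nat using (ℕ)
open import Data.Vec using (Vec)
open import Data.List using (List; []; _∷_; _++_; map)
open import Data.List.Properties using (map-++)
open import Data.List.Relation.Unary.Any using (Any; here; there)
import Data.List.Relation.Unary.All as All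
open import Data.List.Relation.Unary.All.Properties using (++⁻ʳ)
open import Data.List.Relation.Unary.AllPairs using (_∷_)
open import Data.List.Relation.Unary.Unique.Propositional using (Unique)
open import Data.List.Membership.Propositional using (_∈_)
open import Data.Sum using (_⊎_; inj₁; inj₂; [_,_])
open import Data.Product using (_×_; _,_; proj₂)
open import Data.Empty using (⊥; ⊥-elim)
open import Relation.Nullary using (¬_; yes; no)
open import Relation.Binary.PropositionalEquality
  using (_≡_; _≢_; refl; sym; trans; cong; cong-app; subst; module ≡-Reasoning)
open import Relation.Binary.Definitions using (DecidableEquality)

unique-++-disjoint : ∀ {A : Set} (xs ys : List A) {x : A}
  → Unique (xs ++ ys) → x ∈ xs → x ∈ ys → ⊥
unique-++-disjoint (a ∷ xs) ys (a≢rest ∷ _) (here refl) x∈ys =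
  All.lookup (++⁻ʳ xs a≢rest) x∈ys refl
unique-++-disjoint (a ∷ xs) ys (_ ∷ u) (there x∈xs) x∈ys =
  unique-++-disjoint xs ys u x∈xs x∈ys

module Execution (F : Set) (arity : F → ℕ) (V : Set) (_≟V_ : DecidableEquality V) where
  open Schemas F arity V _≟V_

  update-same : ∀ d y t → update d y t y ≡ t
  update-same d y t with y ≟V y
  ... | yes _  = refl
  ... | no y≢y = ⊥-elim (y≢y refl)

  update-other : ∀ d y t v → v ≢ y → update d y t v ≡ d v
  update-other d y t v v≢y with v ≟V y
  ... | yes v≡y = ⊥-elim (v≢y v≡y)
  ... | no _    = refl

  run-++ : ∀ d R S → run d (R ++ S) ≡ run (run d R) S
  run-++ d []      S = refl
  run-++ d (i ∷ R) S = run-++ (step d i) R S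

  assignments-++ : ∀ d R S
    → assignments d (R ++ S) ≡ assignments d R ++ assignments (run d R) S
  assignments-++ d []                  S = refl
  assignments-++ d (skip ∷ R)          S = assignments-++ d R S
  assignments-++ d (assign y f xs ∷ R) S =
    cong (_ ∷_) (assignments-++ (step d (assign y f xs)) R S)

  assignedTerms-++ : ∀ d R S
    → assignedTerms d (R ++ S) ≡ assignedTerms d R ++ assignedTerms (run d R) S
  assignedTerms-++ d R S = begin
    map proj₂ (assignments d (R ++ S))
      ≡⟨ cong (map proj₂) (assignments-++ d R S) ⟩
    map proj₂ (assignments d R ++ assignments (run d R) S)
      ≡⟨ map-++ proj₂ (assignments d R) _ ⟩
    assignedTerms d R ++ assignedTerms (run d R) S ∎
    where open ≡-Reasoning

  record AssignedIn (v : V) (d : State) (S : Schema) : Set where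
    field
      symbol    : F
      instr     : Instr
      instr∈S   : instr ∈ S
      instrForm : AssignsWith symbol v instr
      value     : Vec Term (arity symbol)
      final     : run d S v ≡ app symbol value
      recorded  : app symbol value ∈ assignedTerms d S

  assigned-after : ∀ d i S {t} → t ∈ assignedTerms (step d i) S → t ∈ assignedTerms d (i ∷ S)
  assigned-after d skip           S t∈ = t∈
  assigned-after d (assign _ _ _) S t∈ = there t∈

  assignedIn-∷ : ∀ {v} d i S → AssignedIn v (step d i) S → AssignedIn v d (i ∷ S)
  assignedIn-∷ d i S a = record
    { symbol = symbol ; instr = instr ; instr∈S = there instr∈S
    ; instrForm = instrForm ; value = value ; final = final
    ; recorded = assigned-after d i S recorded }
    where open AssignedIn a

  untouched-or-assigned : ∀ v d S
    → (¬ Any (AssignsTo v) S × run d S v ≡ d v) ⊎ AssignedIn v d S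
  untouched-or-assigned v d [] = inj₁ ((λ ()) , refl)
  untouched-or-assigned v d (skip ∷ S) with untouched-or-assigned v d S
  ... | inj₁ (none , same) = inj₁ ((λ { (there p) → none p }) , same)
  ... | inj₂ a             = inj₂ (assignedIn-∷ d skip S a)
  untouched-or-assigned v d (assign y f xs ∷ S)
    with untouched-or-assigned v (step d (assign y f xs)) S | v ≟V y
  ... | inj₂ a | _ = inj₂ (assignedIn-∷ d (assign y f xs) S a)
  ... | inj₁ (_ , same) | yes refl = inj₂ (record
    { symbol = f ; instr = assign v f xs ; instr∈S = here refl
    ; instrForm = assignsWith xs ; value = Data.Vec.map d xs
    ; final = trans same (update-same d v _) ; recorded = here refl })
  ... | inj₁ (none , same) | no v≢y = inj₁ (none′ , trans same (update-other d y _ v v≢y))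
    where
    none′ : ¬ Any (AssignsTo v) (assign y f xs ∷ S)
    none′ (here (assigns _ _)) = v≢y refl
    none′ (there p)            = none p

  initial-or-assigned : ∀ v R → run e R v ≡ var v ⊎ run e R v ∈ assignedTerms e R
  initial-or-assigned v R with untouched-or-assigned v e R
  ... | inj₁ (_ , same) = inj₁ same
  ... | inj₂ a = inj₂ (subst (_∈ assignedTerms e R) (sym final) recorded)
    where open AssignedIn a

  -- If R S is liberal and S re-assigns v, then the new value of v differs from
  -- its value before S: otherwise that term would be assigned both in R and in S.
  reassigned-differs : ∀ v R S → Unique (assignedTerms e (R ++ S))
    → AssignedIn v (run e R) S → run (run e R) S v ≢ run e R v
  reassigned-differs v R S liberal a changed with initial-or-assigned v R
  ... | inj₁ initial with trans (sym (AssignedIn.final a)) (trans changed initial)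
  ...   | ()
  reassigned-differs v R S liberal a changed | inj₂ inR =
    unique-++-disjoint (assignedTerms e R) _
      (subst Unique (assignedTerms-++ e R S) liberal)
      (subst (_∈ assignedTerms e R) (trans (sym changed) (AssignedIn.final a)) inR)
      (AssignedIn.recorded a)

  app-symbol-injective : ∀ {f g ts us} → app f ts ≡ app g us → f ≡ g
  app-symbol-injective refl = refl

  assigned-both-differ : ∀ v d S₁ S₂
    → ((f : F) (y₁ y₂ : V) (a₁ a₂ : Instr) → a₁ ∈ S₁ → a₂ ∈ S₂
         → AssignsWith f y₁ a₁ → AssignsWith f y₂ a₂ → y₁ ≢ y₂)
    → AssignedIn v d S₁ → AssignedIn v d S₂ → run d S₁ v ≢ run d S₂ v
  assigned-both-differ v d S₁ S₂ separated a₁ a₂ same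
    with app-symbol-injective (trans (sym (AssignedIn.final a₁))
                                     (trans same (AssignedIn.final a₂)))
  ... | refl = separated _ v v _ _ (AssignedIn.instr∈S a₁) (AssignedIn.instr∈S a₂)
                 (AssignedIn.instrForm a₁) (AssignedIn.instrForm a₂) refl

proposition24 : (F : Set) (arity : F → ℕ) (V : Set) (_≟V_ : DecidableEquality V)
    → let open Schemas F arity V _≟V_ in
      (v : V) (R S₁ S₂ : Schema)
    → Any (AssignsTo v) S₁ ⊎ Any (AssignsTo v) S₂
    → Unique (assignedTerms e (R ++ S₁))
    → Unique (assignedTerms e (R ++ S₂))
    → ((f : F) (y₁ y₂ : V) (a₁ a₂ : Instr) → a₁ ∈ S₁ → a₂ ∈ S₂
         → AssignsWith f y₁ a₁ → AssignsWith f y₂ a₂ → y₁ ≢ y₂)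
    → (M[ R ++ S₁ ] e) v ≢ (M[ R ++ S₂ ] e) v
proposition24 F arity V _≟V_ v R S₁ S₂ assignsV liberal₁ liberal₂ separated same =
  compare (untouched-or-assigned v d S₁) (untouched-or-assigned v d S₂)
  where
  open Schemas F arity V _≟V_
  open Execution F arity V _≟V_

  d : State
  d = run e R

  same′ : run d S₁ v ≡ run d S₂ v
  same′ = trans (sym (cong-app (run-++ e R S₁) v)) (trans same (cong-app (run-++ e R S₂) v))

  compare : (¬ Any (AssignsTo v) S₁ × run d S₁ v ≡ d v) ⊎ AssignedIn v d S₁
          → (¬ Any (AssignsTo v) S₂ × run d S₂ v ≡ d v) ⊎ AssignedIn v d S₂ → ⊥
  compare (inj₂ a₁) (inj₂ a₂) = assigned-both-differ v d S₁ S₂ separated a₁ a₂ same′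
  compare (inj₂ a₁) (inj₁ (_ , kept₂)) =
    reassigned-differs v R S₁ liberal₁ a₁ (trans same′ kept₂)
  compare (inj₁ (_ , kept₁)) (inj₂ a₂) =
    reassigned-differs v R S₂ liberal₂ a₂ (trans (sym same′) kept₁)
  compare (inj₁ (none₁ , _)) (inj₁ (none₂ , _)) = [ none₁ , none₂ ] assignsV
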